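{- Let $A,B$ be formulas, $\Phi$ a constraint set, $x_1,\dots,x_n$ resource variables and $p_1,\dots,p_n$ resource polynomials. If $A\le_\Phi B$, then $A\{\overline{p}/\overline{x}\}\le_{\Phi\{\overline{p}/\overline{x}\}}B\{\overline{p}/\overline{x}\}$.
   Context: Resource polynomials: finite sums of finite products $\prod_i\binom{x_i}{n_i}$ (pairwise distinct variables $x_i$, $n_i\in\mathbb{N}$), read as functions of natural-number variables. A constraint is $p\le q$ for resource polynomials $p,q$; $p<q$ abbreviates $p+1\le q$; a constraint set is a finite set of constraints. $\Phi\models c$ means every assignment of naturals to variables satisfying all of $\Phi$ satisfies $c$; $\Phi\models\Psi$ means $\Phi\models c$ for all $c\in\Psi$; $p\sqsubseteq_\Phi q$ means $\Phi\models p\le q$. Formulas: $A::=\alpha(p_1,\dots,p_n)\mid A\otimes A\mid A\multimap A\mid\forall\alpha.A\mid\,!_{x<p}A\mid\forall(x_1,\dots,x_n){:}\Phi.A\mid\exists(x_1,\dots,x_n){:}\Phi.A$, where $\alpha$ ranges over atoms with fixed arities, the $p_i,p$ are resource polynomials, $x\notin FV(p)$, $\Phi$ a constraint set, and (boundedness) for each quantifier formula there are resource polynomials $r_i$ not containing $\overline{x}$ with $\Phi\models\{x_i\le r_i\}_i$. $!_{x<p}$ binds $x$ in its body, first-order quantifiers bind $\overline{x}$ in $\Phi$ and the body, $\forall\alpha$ binds $\alpha$; formulas are taken up to renaming of bound variables and $A\{\overline{p}/\overline{x}\}$, $\Phi\{\overline{p}/\overline{x}\}$ denote capture-avoiding simultaneous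 substitution. Order on formulas: $\alpha(\overline{p})\le_\Phi\alpha(\overline{q})$ iff $p_i\sqsubseteq_\Phi q_i$ for all $i$; $A\otimes B\le_\Phi C\otimes D$ iff $A\le_\Phi C$ and $B\le_\Phi D$; $A\multimap B\le_\Phi C\multimap D$ iff $C\le_\Phi A$ and $B\le_\Phi D$; $\forall\alpha.A\le_\Phi\forall\alpha.B$ iff $A\le_\Phi B$; $!_{x<p}A\le_\Phi\,!_{x<q}B$ iff $q\sqsubseteq_\Phi p$, $x\notin FV(\Phi)$, $A\le_{\Phi\cup\{x<q\}}B$; $\forall\overline{x}{:}\Psi.A\le_\Phi\forall\overline{x}{:}\Theta.B$ iff $\Phi\cup\Theta\models\Psi$, $\overline{x}\notin FV(\Phi)$, $A\le_{\Phi\cup\Theta}B$; $\exists\overline{x}{:}\Psi.A\le_\Phi\exists\overline{x}{:}\Theta.B$ iff $\Phi\cup\Psi\models\Theta$, $\overline{x}\notin FV(\Phi)$, $A\le_{\Phi\cup\Psi}B$. -}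

module Defs where

open import Data.Nat using (ℕ; zero; suc; _+_; _*_; _∸_; _≤_; _≟_)
open import Data.Nat.Combinatorics using (_C_)
open import Data.Fin using (Fin; toℕ)
open import Data.List using (List; []; _∷_; _++_; map; length)
open import Data.List.Relation.Unary.All using (All)
open import Data.List.Relation.Unary.Unique.Propositional using (Unique)
open import Data.List.Relation.Binary.Pointwise using (Pointwise)
open import Data.Product using (Σ; _×_; _,_; proj₁; proj₂)
open import Data.Empty using (⊥)
open import Data.Bool using (if_then_else_)
open import Relation.Nullary.Decidable using (⌊_⌋)
open import Relation.Binary.PropositionalEquality using (_≡_)

-- Resource variables are de Bruijn indices (ℕ).  Free variables of a
-- top-level object are the indices themselves; binders shift indices.
-- Hence formulas are automatically identified up to renaming of bound
-- variables and substitution is automatically capture-avoiding.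

-- A term is a variable or a finite sum of finite
-- products of binomials  binom(t , n)  of terms t.  This syntax is closed
-- under substitution; the actual resource polynomials are the terms in the
-- image of `embed` below (see IsRP).

data Poly : Set where
  var : ℕ → Poly
  rp  : List (List (Poly × ℕ)) → Poly

Assignment : Set
Assignment = ℕ → ℕ

mutual
  eval : Assignment → Poly → ℕ
  eval ρ (var x) = ρ x
  eval ρ (rp ms) = evalS ρ ms

  evalS : Assignment → List (List (Poly × ℕ)) → ℕ
  evalS ρ []       = 0
  evalS ρ (m ∷ ms) = evalM ρ m + evalS ρ ms

  evalM : Assignment → List (Poly × ℕ) → ℕ
  evalM ρ []             = 1
  evalM ρ ((t , n) ∷ m) = (eval ρ t C n) * evalM ρ m

-- Syntactic resource polynomials: finite sums of finite products of
-- binom(x_i , n_i) with pairwise distinct variables x_i in each product.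
RMono : Set
RMono = List (ℕ × ℕ)

RPoly : Set
RPoly = List RMono

embed : RPoly → Poly
embed r = rp (map (map (λ xn → (var (proj₁ xn) , proj₂ xn))) r)

IsRP : Poly → Set
IsRP p = Σ RPoly (λ r → All (λ m → Unique (map proj₁ m)) r × embed r ≡ p)

mutual
  ren : (ℕ → ℕ) → Poly → Poly
  ren f (var x) = var (f x)
  ren f (rp ms) = rp (renS f ms)

  renS : (ℕ → ℕ) → List (List (Poly × ℕ)) → List (List (Poly × ℕ))
  renS f []       = []
  renS f (m ∷ ms) = renM f m ∷ renS f ms

  renM : (ℕ → ℕ) → List (Poly × ℕ) → List (Poly × ℕ)
  renM f []             = []
  renM f ((t , n) ∷ m) = (ren f t , n) ∷ renM f m

mutual
  sub : (ℕ → Poly) → Poly → Poly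
  sub σ (var x) = σ x
  sub σ (rp ms) = rp (subS σ ms)

  subS : (ℕ → Poly) → List (List (Poly × ℕ)) → List (List (Poly × ℕ))
  subS σ []       = []
  subS σ (m ∷ ms) = subM σ m ∷ subS σ ms

  subM : (ℕ → Poly) → List (Poly × ℕ) → List (Poly × ℕ)
  subM σ []             = []
  subM σ ((t , n) ∷ m) = (sub σ t , n) ∷ subM σ m

wk : ℕ → Poly → Poly
wk k = ren (k +_)

lift1 : (ℕ → Poly) → ℕ → Poly
lift1 σ zero    = var zero
lift1 σ (suc i) = wk 1 (σ i)

liftN : ℕ → (ℕ → Poly) → ℕ → Poly
liftN zero    σ = σ
liftN (suc k) σ = lift1 (liftN k σ)

-- p + 1  (binom(p,1) plus the empty product 1)
plus1 : Poly → Poly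
plus1 p = rp (((p , 1) ∷ []) ∷ [] ∷ [])

record Constraint : Set where
  constructor _≤ᶜ_
  field
    lhs : Poly
    rhs : Poly
open Constraint public

_<ᶜ_ : Poly → Poly → Constraint
p <ᶜ q = plus1 p ≤ᶜ q

Constraints : Set
Constraints = List Constraint

Sat : Assignment → Constraint → Set
Sat ρ c = eval ρ (lhs c) ≤ eval ρ (rhs c)

_⊨_ : Constraints → Constraint → Set
Φ ⊨ c = (ρ : Assignment) → All (Sat ρ) Φ → Sat ρ c

_⊨ˢ_ : Constraints → Constraints → Set
Φ ⊨ˢ Ψ = All (Φ ⊨_) Ψ

_⊑[_]_ : Poly → Constraints → Poly → Set
p ⊑[ Φ ] q = Φ ⊨ (p ≤ᶜ q)

subC : (ℕ → Poly) → Constraints → Constraints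
subC σ = map (λ c → sub σ (lhs c) ≤ᶜ sub σ (rhs c))

wkC : ℕ → Constraints → Constraints
wkC k = map (λ c → wk k (lhs c) ≤ᶜ wk k (rhs c))

AllRPC : Constraints → Set
AllRPC Φ = All (λ c → IsRP (lhs c) × IsRP (rhs c)) Φ

-- Atom variables α are de Bruijn indices too (bound by ∀α).
--   atom α ps      α(p_1,…,p_n)
--   all₂ k A       ∀α.A, α (index 0 in A) an atom of arity k
--   bang p A       !_{x<p} A, x = index 0 in A
--   allᶠ n Φ A     ∀(x_1,…,x_n):Φ.A,  x̄ = indices 0..n-1 in Φ and A
--   exᶠ n Φ A      ∃(x_1,…,x_n):Φ.A

data Formula : Set where
  atom : ℕ → List Poly → Formula
  _⊗_  : Formula → Formula → Formula
  _⊸_  : Formula → Formula → Formula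
  all₂ : ℕ → Formula → Formula
  bang : Poly → Formula → Formula
  allᶠ : ℕ → Constraints → Formula → Formula
  exᶠ  : ℕ → Constraints → Formula → Formula

subF : (ℕ → Poly) → Formula → Formula
subF σ (atom a ps)  = atom a (map (sub σ) ps)
subF σ (A ⊗ B)      = subF σ A ⊗ subF σ B
subF σ (A ⊸ B)      = subF σ A ⊸ subF σ B
subF σ (all₂ k A)   = all₂ k (subF σ A)
subF σ (bang p A)   = bang (sub σ p) (subF (liftN 1 σ) A)
subF σ (allᶠ n Φ A) = allᶠ n (subC (liftN n σ) Φ) (subF (liftN n σ) A)
subF σ (exᶠ n Φ A)  = exᶠ n (subC (liftN n σ) Φ) (subF (liftN n σ) A)

mkSub : List (ℕ × Poly) → ℕ → Poly
mkSub []            y = var y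
mkSub ((x , p) ∷ s) y = if ⌊ x ≟ y ⌋ then p else mkSub s y

-- Well-formedness of formulas: polynomials are resource polynomials,
-- atoms are used with their fixed arity (ar gives the arity of each atom
-- index), and every first-order quantifier is bounded.

extAr : ℕ → (ℕ → ℕ) → ℕ → ℕ
extAr k ar zero    = k
extAr k ar (suc i) = ar i

-- ∃ r_1..r_n not containing x̄ (they live outside the binder, hence are
-- weakened by n) with Φ ⊨ {x_i ≤ r_i}
Bounded : ℕ → Constraints → Set
Bounded n Φ = Σ (Fin n → Poly) (λ r →
  ((i : Fin n) → IsRP (r i)) × ((i : Fin n) → Φ ⊨ (var (toℕ i) ≤ᶜ wk n (r i))))

WF : (ℕ → ℕ) → Formula → Set
WF ar (atom a ps)  = (length ps ≡ ar a) × All IsRP ps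
WF ar (A ⊗ B)      = WF ar A × WF ar B
WF ar (A ⊸ B)      = WF ar A × WF ar B
WF ar (all₂ k A)   = WF (extAr k ar) A
WF ar (bang p A)   = IsRP p × WF ar A
WF ar (allᶠ n Φ A) = AllRPC Φ × Bounded n Φ × WF ar A
WF ar (exᶠ n Φ A)  = AllRPC Φ × Bounded n Φ × WF ar A

_≤[_]_ : Formula → Constraints → Formula → Set
atom a ps ≤[ Φ ] atom b qs = (a ≡ b) × Pointwise (λ p q → p ⊑[ Φ ] q) ps qs
(A ⊗ B) ≤[ Φ ] (C ⊗ D) = (A ≤[ Φ ] C) × (B ≤[ Φ ] D)
(A ⊸ B) ≤[ Φ ] (C ⊸ D) = (C ≤[ Φ ] A) × (B ≤[ Φ ] D)
all₂ k A ≤[ Φ ] all₂ l B = (k ≡ l) × (A ≤[ Φ ] B)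
bang p A ≤[ Φ ] bang q B =
  (q ⊑[ Φ ] p) × (A ≤[ (var 0 <ᶜ wk 1 q) ∷ wkC 1 Φ ] B)
allᶠ n Ψ A ≤[ Φ ] allᶠ m Θ B =
  (n ≡ m) × ((wkC n Φ ++ Θ) ⊨ˢ Ψ) × (A ≤[ wkC n Φ ++ Θ ] B)
exᶠ n Ψ A ≤[ Φ ] exᶠ m Θ B =
  (n ≡ m) × ((wkC n Φ ++ Ψ) ⊨ˢ Θ) × (A ≤[ wkC n Φ ++ Ψ ] B)
_ ≤[ _ ] _ = ⊥

module Submission where

open import Defs
open import Data.Nat using (ℕ; suc; _+_; _*_; _≤_)
open import Data.Nat.Combinatorics using (_C_)
open import Data.List using (List; []; _∷_; _++_; map)
open import Data.List.Relation.Unary.All as All using (All; _∷_)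
open import Data.List.Relation.Unary.All.Properties using (++⁻; ++⁺; map⁻; map⁺)
open import Data.List.Relation.Unary.Unique.Propositional using (Unique)
open import Data.List.Relation.Binary.Pointwise as Pointwise using ()
open import Data.Product using (_×_; _,_; proj₁; proj₂)
open import Function using (_∘_)
open import Relation.Binary.PropositionalEquality
  using (_≡_; _≗_; refl; sym; trans; cong; cong₂; subst₂; module ≡-Reasoning)

-- Evaluating pσ under ρ is evaluating p under the assignment eval ρ ∘ σ.  Hence a
-- substitution σ that turns every model of Φ' into a model of Φ turns consequences
-- of Φ into consequences of Φ', after substitution.  This property survives going
-- under a binder (lift σ, weaken both contexts, add the substituted bound
-- constraints), so the order is preserved by induction on the formulas; the
-- theorem is the case Φ' = Φσ.

mutual
  eval-cong : ∀ {ρ ρ'} → ρ ≗ ρ' → ∀ p → eval ρ p ≡ eval ρ' p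
  eval-cong ρ≗ρ' (var x) = ρ≗ρ' x
  eval-cong ρ≗ρ' (rp ms) = evalS-cong ρ≗ρ' ms

  evalS-cong : ∀ {ρ ρ'} → ρ ≗ ρ' → ∀ ms → evalS ρ ms ≡ evalS ρ' ms
  evalS-cong ρ≗ρ' []       = refl
  evalS-cong ρ≗ρ' (m ∷ ms) = cong₂ _+_ (evalM-cong ρ≗ρ' m) (evalS-cong ρ≗ρ' ms)

  evalM-cong : ∀ {ρ ρ'} → ρ ≗ ρ' → ∀ m → evalM ρ m ≡ evalM ρ' m
  evalM-cong ρ≗ρ' []            = refl
  evalM-cong ρ≗ρ' ((t , n) ∷ m) = cong₂ _*_ (cong (_C n) (eval-cong ρ≗ρ' t)) (evalM-cong ρ≗ρ' m)

mutual
  eval-ren : ∀ f ρ p → eval ρ (ren f p) ≡ eval (ρ ∘ f) p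
  eval-ren f ρ (var x) = refl
  eval-ren f ρ (rp ms) = evalS-ren f ρ ms

  evalS-ren : ∀ f ρ ms → evalS ρ (renS f ms) ≡ evalS (ρ ∘ f) ms
  evalS-ren f ρ []       = refl
  evalS-ren f ρ (m ∷ ms) = cong₂ _+_ (evalM-ren f ρ m) (evalS-ren f ρ ms)

  evalM-ren : ∀ f ρ m → evalM ρ (renM f m) ≡ evalM (ρ ∘ f) m
  evalM-ren f ρ []            = refl
  evalM-ren f ρ ((t , n) ∷ m) = cong₂ _*_ (cong (_C n) (eval-ren f ρ t)) (evalM-ren f ρ m)

mutual
  eval-sub : ∀ σ ρ p → eval ρ (sub σ p) ≡ eval (eval ρ ∘ σ) p
  eval-sub σ ρ (var x) = refl
  eval-sub σ ρ (rp ms) = evalS-sub σ ρ ms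

  evalS-sub : ∀ σ ρ ms → evalS ρ (subS σ ms) ≡ evalS (eval ρ ∘ σ) ms
  evalS-sub σ ρ []       = refl
  evalS-sub σ ρ (m ∷ ms) = cong₂ _+_ (evalM-sub σ ρ m) (evalS-sub σ ρ ms)

  evalM-sub : ∀ σ ρ m → evalM ρ (subM σ m) ≡ evalM (eval ρ ∘ σ) m
  evalM-sub σ ρ []            = refl
  evalM-sub σ ρ ((t , n) ∷ m) = cong₂ _*_ (cong (_C n) (eval-sub σ ρ t)) (evalM-sub σ ρ m)

eval-liftN : ∀ n σ ρ → eval ρ ∘ liftN n σ ∘ (n +_) ≗ eval (ρ ∘ (n +_)) ∘ σ
eval-liftN 0       σ ρ x = refl
eval-liftN (suc n) σ ρ x =
  trans (eval-ren (1 +_) ρ (liftN n σ (n + x))) (eval-liftN n σ (ρ ∘ suc) x)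

eval-wk-sub : ∀ n σ ρ p → eval ρ (wk n (sub σ p)) ≡ eval (eval ρ ∘ liftN n σ) (wk n p)
eval-wk-sub n σ ρ p = begin
  eval ρ (wk n (sub σ p))                   ≡⟨ eval-ren (n +_) ρ (sub σ p) ⟩
  eval (ρ ∘ (n +_)) (sub σ p)               ≡⟨ eval-sub σ (ρ ∘ (n +_)) p ⟩
  eval (eval (ρ ∘ (n +_)) ∘ σ) p            ≡⟨ eval-cong (sym ∘ eval-liftN n σ ρ) p ⟩
  eval (eval ρ ∘ liftN n σ ∘ (n +_)) p      ≡⟨ eval-ren (n +_) (eval ρ ∘ liftN n σ) p ⟨
  eval (eval ρ ∘ liftN n σ) (wk n p)        ∎
  where open ≡-Reasoning

subᶜ : (ℕ → Poly) → Constraint → Constraint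
subᶜ σ c = sub σ (lhs c) ≤ᶜ sub σ (rhs c)

Sat-cong : ∀ {ρ ρ'} → ρ ≗ ρ' → ∀ c → Sat ρ c → Sat ρ' c
Sat-cong ρ≗ρ' c = subst₂ _≤_ (eval-cong ρ≗ρ' (lhs c)) (eval-cong ρ≗ρ' (rhs c))

Sat-subᶜ⁺ : ∀ σ ρ c → Sat (eval ρ ∘ σ) c → Sat ρ (subᶜ σ c)
Sat-subᶜ⁺ σ ρ c = subst₂ _≤_ (sym (eval-sub σ ρ (lhs c))) (sym (eval-sub σ ρ (rhs c)))

Sat-subᶜ⁻ : ∀ σ ρ c → Sat ρ (subᶜ σ c) → Sat (eval ρ ∘ σ) c
Sat-subᶜ⁻ σ ρ c = subst₂ _≤_ (eval-sub σ ρ (lhs c)) (eval-sub σ ρ (rhs c))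

Sat-wkC⁺ : ∀ n ρ Φ → All (Sat (ρ ∘ (n +_))) Φ → All (Sat ρ) (wkC n Φ)
Sat-wkC⁺ n ρ Φ = map⁺ ∘ All.map λ {c} →
  subst₂ _≤_ (sym (eval-ren (n +_) ρ (lhs c))) (sym (eval-ren (n +_) ρ (rhs c)))

Sat-wkC⁻ : ∀ n ρ Φ → All (Sat ρ) (wkC n Φ) → All (Sat (ρ ∘ (n +_))) Φ
Sat-wkC⁻ n ρ Φ = All.map (λ {c} →
  subst₂ _≤_ (eval-ren (n +_) ρ (lhs c)) (eval-ren (n +_) ρ (rhs c))) ∘ map⁻

-- Φ' ⊨[ σ ] Φ : σ sends every model of Φ' to a model of Φ, i.e. Φ' ⊨ Φσ.
-- A record rather than a function type, so that σ, Φ and Φ' are inferable.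
record _⊨[_]_ (Φ' : Constraints) (σ : ℕ → Poly) (Φ : Constraints) : Set where
  constructor mk⊨[]
  field models : ∀ ρ → All (Sat ρ) Φ' → All (Sat (eval ρ ∘ σ)) Φ
open _⊨[_]_

subC-⊨[] : ∀ σ Φ → subC σ Φ ⊨[ σ ] Φ
subC-⊨[] σ Φ = mk⊨[] λ ρ → All.map (λ {c} → Sat-subᶜ⁻ σ ρ c) ∘ map⁻

++-⊨[] : ∀ {σ Φ₁ Φ₂ Φ₁' Φ₂'} → Φ₁' ⊨[ σ ] Φ₁ → Φ₂' ⊨[ σ ] Φ₂ → (Φ₁' ++ Φ₂') ⊨[ σ ] (Φ₁ ++ Φ₂)
++-⊨[] {Φ₁' = Φ₁'} H₁ H₂ = mk⊨[] λ ρ hs →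
  let hs₁ , hs₂ = ++⁻ Φ₁' hs in ++⁺ (models H₁ ρ hs₁) (models H₂ ρ hs₂)

wkC-⊨[] : ∀ n {σ Φ Φ'} → Φ' ⊨[ σ ] Φ → wkC n Φ' ⊨[ liftN n σ ] wkC n Φ
wkC-⊨[] n {σ} {Φ} {Φ'} H = mk⊨[] λ ρ hs →
  Sat-wkC⁺ n (eval ρ ∘ liftN n σ) Φ
    (All.map (λ {c} → Sat-cong (sym ∘ eval-liftN n σ ρ) c)
      (models H (ρ ∘ (n +_)) (Sat-wkC⁻ n ρ Φ' hs)))

binder-⊨[] : ∀ n {σ Φ Φ'} Θ → Φ' ⊨[ σ ] Φ
  → (wkC n Φ' ++ subC (liftN n σ) Θ) ⊨[ liftN n σ ] (wkC n Φ ++ Θ)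
binder-⊨[] n {σ} Θ H = ++-⊨[] (wkC-⊨[] n H) (subC-⊨[] (liftN n σ) Θ)

-- The bound constraint of the substituted formula is x < wk (qσ) rather than
-- (x < wk q) under the lifted σ; the two agree semantically by eval-wk-sub.
bang-⊨[] : ∀ {σ Φ Φ'} q → Φ' ⊨[ σ ] Φ
  → ((var 0 <ᶜ wk 1 (sub σ q)) ∷ wkC 1 Φ') ⊨[ liftN 1 σ ] ((var 0 <ᶜ wk 1 q) ∷ wkC 1 Φ)
bang-⊨[] {σ} q H = mk⊨[] λ where
  ρ (h ∷ hs) → subst₂ _≤_ refl (eval-wk-sub 1 σ ρ q) h ∷ models (wkC-⊨[] 1 H) ρ hs

⊨-subᶜ : ∀ {σ Φ Φ'} c → Φ ⊨ c → Φ' ⊨[ σ ] Φ → Φ' ⊨ subᶜ σ c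
⊨-subᶜ {σ} c Φ⊨c H ρ = Sat-subᶜ⁺ σ ρ c ∘ Φ⊨c (eval ρ ∘ σ) ∘ models H ρ

⊨ˢ-subC : ∀ {σ Φ Φ' Ψ} → Φ ⊨ˢ Ψ → Φ' ⊨[ σ ] Φ → Φ' ⊨ˢ subC σ Ψ
⊨ˢ-subC Φ⊨Ψ H = map⁺ (All.map (λ {c} Φ⊨c → ⊨-subᶜ c Φ⊨c H) Φ⊨Ψ)

subF-mono : ∀ {σ Φ Φ'} → Φ' ⊨[ σ ] Φ → ∀ A B → A ≤[ Φ ] B → subF σ A ≤[ Φ' ] subF σ B
subF-mono H (atom a ps) (atom b qs) (a≡b , ps≤qs) =
  a≡b , Pointwise.map⁺ _ _ (Pointwise.map (λ {p} {q} p⊑q → ⊨-subᶜ (p ≤ᶜ q) p⊑q H) ps≤qs)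
subF-mono H (A₁ ⊗ A₂) (B₁ ⊗ B₂) (A₁≤B₁ , A₂≤B₂) = subF-mono H A₁ B₁ A₁≤B₁ , subF-mono H A₂ B₂ A₂≤B₂
subF-mono H (A₁ ⊸ A₂) (B₁ ⊸ B₂) (B₁≤A₁ , A₂≤B₂) = subF-mono H B₁ A₁ B₁≤A₁ , subF-mono H A₂ B₂ A₂≤B₂
subF-mono H (all₂ k A) (all₂ l B) (k≡l , A≤B) = k≡l , subF-mono H A B A≤B
subF-mono H (bang p A) (bang q B) (q⊑p , A≤B) =
  ⊨-subᶜ (q ≤ᶜ p) q⊑p H , subF-mono (bang-⊨[] q H) A B A≤B
subF-mono H (allᶠ n Ψ A) (allᶠ .n Θ B) (refl , ⊨Ψ , A≤B) =
  refl , ⊨ˢ-subC ⊨Ψ (binder-⊨[] n Θ H) , subF-mono (binder-⊨[] n Θ H) A B A≤B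
subF-mono H (exᶠ n Ψ A) (exᶠ .n Θ B) (refl , ⊨Θ , A≤B) =
  refl , ⊨ˢ-subC ⊨Θ (binder-⊨[] n Ψ H) , subF-mono (binder-⊨[] n Ψ H) A B A≤B
subF-mono H (atom _ _)   (_ ⊗ _)      ()
subF-mono H (atom _ _)   (_ ⊸ _)      ()
subF-mono H (atom _ _)   (all₂ _ _)   ()
subF-mono H (atom _ _)   (bang _ _)   ()
subF-mono H (atom _ _)   (allᶠ _ _ _) ()
subF-mono H (atom _ _)   (exᶠ _ _ _)  ()
subF-mono H (_ ⊗ _)      (atom _ _)   ()
subF-mono H (_ ⊗ _)      (_ ⊸ _)      ()
subF-mono H (_ ⊗ _)      (all₂ _ _)   ()
subF-mono H (_ ⊗ _)      (bang _ _)   ()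
subF-mono H (_ ⊗ _)      (allᶠ _ _ _) ()
subF-mono H (_ ⊗ _)      (exᶠ _ _ _)  ()
subF-mono H (_ ⊸ _)      (atom _ _)   ()
subF-mono H (_ ⊸ _)      (_ ⊗ _)      ()
subF-mono H (_ ⊸ _)      (all₂ _ _)   ()
subF-mono H (_ ⊸ _)      (bang _ _)   ()
subF-mono H (_ ⊸ _)      (allᶠ _ _ _) ()
subF-mono H (_ ⊸ _)      (exᶠ _ _ _)  ()
subF-mono H (all₂ _ _)   (atom _ _)   ()
subF-mono H (all₂ _ _)   (_ ⊗ _)      ()
subF-mono H (all₂ _ _)   (_ ⊸ _)      ()
subF-mono H (all₂ _ _)   (bang _ _)   ()
subF-mono H (all₂ _ _)   (allᶠ _ _ _) ()
subF-mono H (all₂ _ _)   (exᶠ _ _ _)  ()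
subF-mono H (bang _ _)   (atom _ _)   ()
subF-mono H (bang _ _)   (_ ⊗ _)      ()
subF-mono H (bang _ _)   (_ ⊸ _)      ()
subF-mono H (bang _ _)   (all₂ _ _)   ()
subF-mono H (bang _ _)   (allᶠ _ _ _) ()
subF-mono H (bang _ _)   (exᶠ _ _ _)  ()
subF-mono H (allᶠ _ _ _) (atom _ _)   ()
subF-mono H (allᶠ _ _ _) (_ ⊗ _)      ()
subF-mono H (allᶠ _ _ _) (_ ⊸ _)      ()
subF-mono H (allᶠ _ _ _) (all₂ _ _)   ()
subF-mono H (allᶠ _ _ _) (bang _ _)   ()
subF-mono H (allᶠ _ _ _) (exᶠ _ _ _)  ()
subF-mono H (exᶠ _ _ _)  (atom _ _)   ()
subF-mono H (exᶠ _ _ _)  (_ ⊗ _)      ()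
subF-mono H (exᶠ _ _ _)  (_ ⊸ _)      ()
subF-mono H (exᶠ _ _ _)  (all₂ _ _)   ()
subF-mono H (exᶠ _ _ _)  (bang _ _)   ()
subF-mono H (exᶠ _ _ _)  (allᶠ _ _ _) ()

lemma2p11 : (ar : ℕ → ℕ) (A B : Formula) (Φ : Constraints) (s : List (ℕ × Poly))
    → WF ar A → WF ar B → AllRPC Φ
    → Unique (map proj₁ s) → All (λ xp → IsRP (proj₂ xp)) s
    → A ≤[ Φ ] B
    → subF (mkSub s) A ≤[ subC (mkSub s) Φ ] subF (mkSub s) B
lemma2p11 ar A B Φ s _ _ _ _ _ A≤B = subF-mono (subC-⊨[] (mkSub s) Φ) A B A≤B
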